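{- If $G$ is a diamond-free graph, then $\chi_{\mathrm{gp}}(G)\le\gamma_t(G)$.
   Context: A diamond is $K_4$ minus one edge; $G$ is diamond-free if it contains no subgraph isomorphic to a diamond. $\gamma_t(G)$ is the total domination number: the minimum size of $S\subseteq V(G)$ such that every vertex of $G$ is adjacent to some vertex of $S$. A set is in general position if no shortest path contains more than two of its vertices; $\chi_{\mathrm{gp}}(G)$ is the minimum number of colours in a colouring of $V(G)$ with each colour class in general position. -}

module Defs where

open import Data.Nat using (ℕ; zero; suc; _≤_)
open import Data.Fin using (Fin)
open import Data.Fin.Subset using (Subset; _∈_; ∣_∣)
open import Data.Product using (Σ; ∃; _×_; _,_)
open import Data.Empty using (⊥)
open import Relation.Nullary using (¬_)
open import Relation.Binary.PropositionalEquality using (_≡_; _≢_)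
open import Level using (0ℓ)

record Graph (n : ℕ) : Set₁ where
  field
    Adj   : Fin n → Fin n → Set
    sym   : ∀ {u v} → Adj u v → Adj v u
    irrefl : ∀ {u} → ¬ Adj u u
open Graph public

module _ {n : ℕ} (G : Graph n) where

  data Walk : Fin n → Fin n → Set where
    stop : ∀ {u} → Walk u u
    step : ∀ {u w v} → Adj G u w → Walk w v → Walk u v

  walkLength : ∀ {u v} → Walk u v → ℕ
  walkLength stop = zero
  walkLength (step _ W) = suc (walkLength W)

  data OnWalk (x : Fin n) : ∀ {u v} → Walk u v → Set where
    here  : ∀ {v} {W : Walk x v} → OnWalk x W
    there : ∀ {u w v} {e : Adj G u w} {W : Walk w v} → OnWalk x W → OnWalk x (step e W)

  IsShortest : ∀ {u v} → Walk u v → Set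
  IsShortest {u} {v} W = ∀ (W' : Walk u v) → walkLength W ≤ walkLength W'

  GeneralPosition : (Fin n → Set) → Set
  GeneralPosition S =
    ∀ {u v} (W : Walk u v) → IsShortest W →
    ∀ x y z → S x → S y → S z → x ≢ y → x ≢ z → y ≢ z →
    OnWalk x W → OnWalk y W → OnWalk z W → ⊥

  GPColouring : ℕ → Set
  GPColouring k = Σ (Fin n → Fin k) λ c → ∀ (i : Fin k) → GeneralPosition (λ x → c x ≡ i)

  TotalDominating : Subset n → Set
  TotalDominating S = ∀ v → ∃ λ u → u ∈ S × Adj G v u

  -- G contains a diamond (K4 minus an edge) as a (not necessarily induced) subgraph:
  -- distinct a b c d with edges ab, ac, bc, ad, bd
  DiamondFree : Set
  DiamondFree =
    ∀ a b c d → a ≢ b → a ≢ c → a ≢ d → b ≢ c → b ≢ d → c ≢ d →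
    Adj G a b → Adj G a c → Adj G b c → Adj G a d → Adj G b d → ⊥

-- Colour each vertex by a chosen neighbour in the total dominating set S; then every colour
-- class lies in the open neighbourhood N(s) of a single s ∈ S. Two vertices of N(s) are at
-- distance at most 2, so three of them on a shortest path are consecutive, x – y – z; together
-- with s they span a diamond. Hence in a diamond-free graph every N(s) is in general position.
module Submission where

open import Defs
open import Data.Nat using (ℕ; _≤_; s≤s)
open import Data.Nat.Properties using (≤-refl; ≤-trans; n≤1+n; 1+n≰n)
open import Data.Fin using (Fin; zero; suc)
open import Data.Fin.Properties using (suc-injective)
open import Data.Fin.Subset using (Subset; _∈_; ∣_∣; inside; outside)
open import Data.Vec.Base using (here; there)
open import Data.Product using (Σ; _,_; proj₁; proj₂)
open import Data.Empty using (⊥)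
open import Relation.Binary.PropositionalEquality as ≡ using (_≡_; _≢_; refl; cong)

rank : ∀ {n} {p : Subset n} {x : Fin n} → x ∈ p → Fin ∣ p ∣
rank here                         = zero
rank (there {y = inside}  x∈p) = suc (rank x∈p)
rank (there {y = outside} x∈p) = rank x∈p

rank-injective : ∀ {n} {p : Subset n} {x y : Fin n} (x∈p : x ∈ p) (y∈p : y ∈ p) →
  rank x∈p ≡ rank y∈p → x ≡ y
rank-injective here                      here        _  = refl
rank-injective here                      (there {y = inside} _) ()
rank-injective (there {y = inside}  _)   here        ()
rank-injective (there {y = inside}  x∈p) (there y∈p) eq = cong suc (rank-injective x∈p y∈p (suc-injective eq))
rank-injective (there {y = outside} x∈p) (there y∈p) eq = cong suc (rank-injective x∈p y∈p eq)

module _ {n : ℕ} (G : Graph n) where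

  Adj⇒≢ : ∀ {u v} → Adj G u v → u ≢ v
  Adj⇒≢ uv refl = irrefl G uv

  IsShortest-tail : ∀ {u w v} {e : Adj G u w} {W : Walk G w v} →
    IsShortest G (step e W) → IsShortest G W
  IsShortest-tail {e = e} shortest W′ with shortest (step e W′)
  ... | s≤s le = le

  walkFrom : ∀ {u v y} {W : Walk G u v} → OnWalk G y W →
    Σ (Walk G y v) λ W′ → walkLength G W′ ≤ walkLength G W
  walkFrom here = _ , ≤-refl
  walkFrom (there y∈W) with walkFrom y∈W
  ... | W′ , le = W′ , ≤-trans le (n≤1+n _)

  shortest-beyond-distance-two : ∀ {x w₁ w₂ w₃ v s y}
    {e₁ : Adj G x w₁} {e₂ : Adj G w₁ w₂} {e₃ : Adj G w₂ w₃} {W : Walk G w₃ v} →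
    IsShortest G (step e₁ (step e₂ (step e₃ W))) →
    Adj G s x → Adj G s y → OnWalk G y W → ⊥
  shortest-beyond-distance-two shortest sx sy y∈W with walkFrom y∈W
  ... | W′ , le = 1+n≰n (≤-trans (shortest (step (sym G sx) (step sy W′))) (s≤s (s≤s le)))

  module _ (diamondFree : DiamondFree G) where

    neighbourhood-P₃-free : ∀ {s x y z} → Adj G s x → Adj G s y → Adj G s z →
      Adj G x y → Adj G y z → x ≢ z → ⊥
    neighbourhood-P₃-free sx sy sz xy yz x≢z =
      diamondFree _ _ _ _ (Adj⇒≢ sy) (Adj⇒≢ sx) (Adj⇒≢ sz)
        (λ y≡x → Adj⇒≢ xy (≡.sym y≡x)) (Adj⇒≢ yz) x≢z
        sy sx (sym G xy) sz yz

    neighbourhood-generalPosition-head : ∀ {s x v} (W : Walk G x v) → IsShortest G W →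
      ∀ y z → Adj G s x → Adj G s y → Adj G s z → x ≢ y → x ≢ z → y ≢ z →
      OnWalk G y W → OnWalk G z W → ⊥
    neighbourhood-generalPosition-head _ _ _ _ _ _ _ x≢y _ _ here _ = x≢y refl
    neighbourhood-generalPosition-head _ _ _ _ _ _ _ _ x≢z _ _ here = x≢z refl
    neighbourhood-generalPosition-head _ _ _ _ _ _ _ _ _ y≢z (there here) (there here) = y≢z refl
    neighbourhood-generalPosition-head _ _ _ _ _ _ _ _ _ y≢z (there (there here)) (there (there here)) = y≢z refl
    neighbourhood-generalPosition-head (step e₁ (step e₂ (step e₃ W))) shortest _ _ sx sy _ _ _ _ (there (there (there y∈W))) _ =
      shortest-beyond-distance-two {e₁ = e₁} {e₂} {e₃} {W} shortest sx sy y∈W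
    neighbourhood-generalPosition-head (step e₁ (step e₂ (step e₃ W))) shortest _ _ sx _ sz _ _ _ _ (there (there (there z∈W))) =
      shortest-beyond-distance-two {e₁ = e₁} {e₂} {e₃} {W} shortest sx sz z∈W
    neighbourhood-generalPosition-head (step xy (step yz _)) _ _ _ sx sy sz _ x≢z _ (there here) (there (there here)) =
      neighbourhood-P₃-free sx sy sz xy yz x≢z
    neighbourhood-generalPosition-head (step xz (step zy _)) _ _ _ sx sy sz x≢y _ _ (there (there here)) (there here) =
      neighbourhood-P₃-free sx sz sy xz zy x≢y

    neighbourhood-generalPosition : ∀ s → GeneralPosition G (Adj G s)
    neighbourhood-generalPosition s W shortest x y z sx sy sz x≢y x≢z y≢z here y∈W z∈W =
      neighbourhood-generalPosition-head W shortest y z sx sy sz x≢y x≢z y≢z y∈W z∈W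
    neighbourhood-generalPosition s W shortest x y z sx sy sz x≢y x≢z y≢z x∈W here z∈W =
      neighbourhood-generalPosition-head W shortest x z sy sx sz (λ y≡x → x≢y (≡.sym y≡x)) y≢z x≢z x∈W z∈W
    neighbourhood-generalPosition s W shortest x y z sx sy sz x≢y x≢z y≢z x∈W y∈W here =
      neighbourhood-generalPosition-head W shortest x y sz sx sy
        (λ z≡x → x≢z (≡.sym z≡x)) (λ z≡y → y≢z (≡.sym z≡y)) x≢y x∈W y∈W
    neighbourhood-generalPosition s (step e W) shortest x y z sx sy sz x≢y x≢z y≢z (there x∈W) (there y∈W) (there z∈W) =
      neighbourhood-generalPosition s W (IsShortest-tail {e = e} shortest) x y z sx sy sz x≢y x≢z y≢z x∈W y∈W z∈W

  module _ (S : Subset n) (totalDominating : TotalDominating G S) where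

    dominator : Fin n → Fin n
    dominator v = proj₁ (totalDominating v)

    dominator-adj : ∀ v → Adj G (dominator v) v
    dominator-adj v = sym G (proj₂ (proj₂ (totalDominating v)))

    dominatorColour : Fin n → Fin ∣ S ∣
    dominatorColour v = rank (proj₁ (proj₂ (totalDominating v)))

    dominatorColour-class⊆neighbourhood : ∀ {x y} →
      dominatorColour x ≡ dominatorColour y → Adj G (dominator x) y
    dominatorColour-class⊆neighbourhood {x} {y} same =
      ≡.subst (λ d → Adj G d y) (≡.sym dx≡dy) (dominator-adj y)
      where
      dx≡dy : dominator x ≡ dominator y
      dx≡dy = rank-injective (proj₁ (proj₂ (totalDominating x))) (proj₁ (proj₂ (totalDominating y))) same

mainTheorem12 : ∀ {n : ℕ} (G : Graph n) → DiamondFree G →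
    ∀ (S : Subset n) → TotalDominating G S → GPColouring G ∣ S ∣
mainTheorem12 G diamondFree S totalDominating = colour , colourClass-generalPosition
  where
  colour : Fin _ → Fin ∣ S ∣
  colour = dominatorColour G S totalDominating

  colourClass-generalPosition : ∀ i → GeneralPosition G (λ x → colour x ≡ i)
  colourClass-generalPosition i W shortest x y z refl cy cz =
    neighbourhood-generalPosition G diamondFree (dominator G S totalDominating x) W shortest x y z
      (dominator-adj G S totalDominating x)
      (dominatorColour-class⊆neighbourhood G S totalDominating (≡.sym cy))
      (dominatorColour-class⊆neighbourhood G S totalDominating (≡.sym cz))
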